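{- Let $G$ be a nontrivial uniquely $C_4^{+}$-saturated graph, let $S=\{v_1,v_2,v_3\}$ be the vertex set of a triangle in $G$, and for $i\in\{1,2,3\}$ let $V_i=N(v_i)\setminus S$. Then: (i) $V(G)=S\cup N(S)\cup N^{2}(S)$, and these three sets form a partition of $V(G)$; (ii) $V_i\cap V_j=\emptyset$ for $i\neq j$; (iii) $N(S)=V_1\cup V_2\cup V_3$ is an independent set in $G$; (iv) each vertex in $N^{2}(S)$ has one or two neighbors in each $V_i$, $i\in\{1,2,3\}$.
   Context: All graphs are finite, simple and undirected. $C_4^{+}$ (the diamond) is the graph obtained from a $4$-cycle by adding one chord, i.e. $K_4$ minus an edge. For a graph $H$, a graph $G$ is uniquely $H$-saturated if $G$ contains no subgraph isomorphic to $H$, but for every pair of non-adjacent vertices $u,v$ of $G$, the graph $G+uv$ contains exactly one subgraph isomorphic to $H$. A uniquely $H$-saturated graph is nontrivial if it has at least $|V(H)|$ vertices. $N(v)$ denotes the neighborhood of $v$. For $U\subseteq V(G)$, $d(v,U)=\min\{d(v,u):u\in U\}$ (graph distance), $N(U)=\{v\in V(G): d(v,U)=1\}$ and $N^{k}(U)=\{v\in V(G): d(v,U)=k\}$. -}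

module Defs where

open import Data.Nat using (ℕ; _≤_)
open import Data.Bool using (Bool; true; false)
open import Data.Bool.Properties using () renaming (_≟_ to _≟B_)
open import Data.Fin using (Fin; zero; suc)
open import Data.Fin.Properties using (any?)
open import Data.Product using (Σ; ∃; ∃-syntax; _×_; _,_)
open import Data.Sum using (_⊎_)
open import Data.List using (List; length; filter)
open import Data.List.Base using ()
open import Data.Fin.Base using ()
open import Data.Vec.Functional using ()
open import Function using (_⇔_)
open import Function.Definitions using (Injective)
open import Relation.Nullary using (¬_; Dec)
open import Relation.Nullary.Decidable using (_×-dec_; ¬?)
open import Relation.Binary.PropositionalEquality using (_≡_)
import Data.List as L
import Data.Fin as F

record Graph (n : ℕ) : Set where
  field
    adj    : Fin n → Fin n → Bool
    sym    : ∀ u v → adj u v ≡ adj v u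
    irrefl : ∀ v → adj v v ≡ false
open Graph public

Adj : ∀ {n} → Graph n → Fin n → Fin n → Set
Adj G u v = adj G u v ≡ true

Adj? : ∀ {n} (G : Graph n) (u v : Fin n) → Dec (Adj G u v)
Adj? G u v = adj G u v ≟B true

-- The diamond C4+ = K4 minus the edge {2,3} (spine {0,1}, tips 2 and 3).
diamondAdj : Fin 4 → Fin 4 → Bool
diamondAdj zero zero = false
diamondAdj zero (suc _) = true
diamondAdj (suc zero) zero = true
diamondAdj (suc zero) (suc zero) = false
diamondAdj (suc zero) (suc (suc _)) = true
diamondAdj (suc (suc zero)) zero = true
diamondAdj (suc (suc zero)) (suc zero) = true
diamondAdj (suc (suc zero)) (suc (suc _)) = false
diamondAdj (suc (suc (suc zero))) zero = true
diamondAdj (suc (suc (suc zero))) (suc zero) = true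
diamondAdj (suc (suc (suc zero))) (suc (suc _)) = false

diamondSym : ∀ u v → diamondAdj u v ≡ diamondAdj v u
diamondSym zero zero = _≡_.refl
diamondSym zero (suc zero) = _≡_.refl
diamondSym zero (suc (suc zero)) = _≡_.refl
diamondSym zero (suc (suc (suc zero))) = _≡_.refl
diamondSym (suc zero) zero = _≡_.refl
diamondSym (suc zero) (suc zero) = _≡_.refl
diamondSym (suc zero) (suc (suc zero)) = _≡_.refl
diamondSym (suc zero) (suc (suc (suc zero))) = _≡_.refl
diamondSym (suc (suc zero)) zero = _≡_.refl
diamondSym (suc (suc zero)) (suc zero) = _≡_.refl
diamondSym (suc (suc zero)) (suc (suc zero)) = _≡_.refl
diamondSym (suc (suc zero)) (suc (suc (suc zero))) = _≡_.refl
diamondSym (suc (suc (suc zero))) zero = _≡_.refl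
diamondSym (suc (suc (suc zero))) (suc zero) = _≡_.refl
diamondSym (suc (suc (suc zero))) (suc (suc zero)) = _≡_.refl
diamondSym (suc (suc (suc zero))) (suc (suc (suc zero))) = _≡_.refl

diamondIrrefl : ∀ v → diamondAdj v v ≡ false
diamondIrrefl zero = _≡_.refl
diamondIrrefl (suc zero) = _≡_.refl
diamondIrrefl (suc (suc zero)) = _≡_.refl
diamondIrrefl (suc (suc (suc zero))) = _≡_.refl

Diamond : Graph 4
Diamond = record { adj = diamondAdj ; sym = diamondSym ; irrefl = diamondIrrefl }

record Embedding {m n : ℕ} (H : Graph m) (R : Fin n → Fin n → Set) : Set where
  field
    map   : Fin m → Fin n
    inj   : Injective _≡_ _≡_ map
    edges : ∀ a b → Adj H a b → R (map a) (map b)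
open Embedding public

ImgVertex : ∀ {m n} {H : Graph m} {R : Fin n → Fin n → Set} → Embedding H R → Fin n → Set
ImgVertex f x = ∃[ a ] (map f a ≡ x)

ImgEdge : ∀ {m n} {H : Graph m} {R : Fin n → Fin n → Set} → Embedding H R → Fin n → Fin n → Set
ImgEdge {H = H} f x y = ∃[ a ] ∃[ b ] (Adj H a b × map f a ≡ x × map f b ≡ y)

SameSubgraph : ∀ {m n} {H : Graph m} {R : Fin n → Fin n → Set} → Embedding H R → Embedding H R → Set
SameSubgraph f g = (∀ x → ImgVertex f x ⇔ ImgVertex g x) × (∀ x y → ImgEdge f x y ⇔ ImgEdge g x y)

ExactlyOneCopy : ∀ {m n} (H : Graph m) (R : Fin n → Fin n → Set) → Set
ExactlyOneCopy H R = Σ (Embedding H R) λ f → ∀ (g : Embedding H R) → SameSubgraph f g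

AdjPlus : ∀ {n} → Graph n → Fin n → Fin n → Fin n → Fin n → Set
AdjPlus G u v x y = Adj G x y ⊎ ((x ≡ u × y ≡ v) ⊎ (x ≡ v × y ≡ u))

UniquelySaturated : ∀ {m n} → Graph m → Graph n → Set
UniquelySaturated H G =
  ¬ Embedding H (Adj G) ×
  (∀ u v → ¬ u ≡ v → ¬ Adj G u v → ExactlyOneCopy H (AdjPlus G u v))

NontrivialUniquelySaturated : ∀ {m n} → Graph m → Graph n → Set
NontrivialUniquelySaturated {m} {n} H G = m ≤ n × UniquelySaturated H G

NSet : ∀ {n} → Graph n → (Fin n → Set) → Fin n → Set
NSet G S x = ¬ S x × ∃[ s ] (S s × Adj G s x)

N2Set : ∀ {n} → Graph n → (Fin n → Set) → Fin n → Set
N2Set G S x = ¬ S x × ¬ NSet G S x × ∃[ y ] (NSet G S y × Adj G y x)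

IsTriangle : ∀ {n} → Graph n → (Fin 3 → Fin n) → Set
IsTriangle G t = ∀ i j → ¬ i ≡ j → Adj G (t i) (t j)

TriS : ∀ {n} → (Fin 3 → Fin n) → Fin n → Set
TriS t x = ∃[ i ] (x ≡ t i)

TriS? : ∀ {n} (t : Fin 3 → Fin n) (x : Fin n) → Dec (TriS t x)
TriS? t x = any? (λ i → x F.≟ t i)

Vi : ∀ {n} → Graph n → (Fin 3 → Fin n) → Fin 3 → Fin n → Set
Vi G t i x = Adj G (t i) x × ¬ TriS t x

Vi? : ∀ {n} (G : Graph n) (t : Fin 3 → Fin n) (i : Fin 3) (x : Fin n) → Dec (Vi G t i x)
Vi? G t i x = Adj? G (t i) x ×-dec ¬? (TriS? t x)

nbrsInVi : ∀ {n} → Graph n → (Fin 3 → Fin n) → Fin 3 → Fin n → ℕ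
nbrsInVi {n} G t i x = length (filter (λ y → Vi? G t i y ×-dec Adj? G x y) (L.allFin n))

{-# OPTIONS --safe #-}
module Submission where

-- As G has no diamond, an edge lies in at most one triangle;
-- this gives (ii). Adding a non-edge uv creates a diamond, which contains uv inside one
-- of its triangles, so u and v have a common neighbour; uniqueness of that diamond
-- forbids a second diamond through uv, in particular three common neighbours of u and v.
-- Applied to x and v_i for x outside S ∪ N(S) this gives (i) and (iv). For (iii), an edge
-- xy with x ∈ V_i, y ∈ N(S) would make G + x v_j contain, besides the diamond on
-- S ∪ {x}, a second one through y.

open import Defs
open import Data.Nat using (ℕ; _≤_; z≤n; s≤s)
open import Data.Fin using (Fin; zero; suc; _≟_)
open import Data.Fin.Properties using (all?; any?)
open import Data.Product using (∃-syntax; _×_; _,_; proj₁; proj₂; map₂)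
open import Data.Sum using (_⊎_; inj₁; inj₂)
open import Data.Empty using (⊥; ⊥-elim)
open import Data.List using (List; []; _∷_; length; filter; allFin)
open import Data.List.Relation.Unary.All using (All; _∷_)
open import Data.List.Relation.Unary.All.Properties using (all-filter)
open import Data.List.Relation.Unary.AllPairs using (_∷_)
open import Data.List.Relation.Unary.Unique.Propositional using (Unique)
open import Data.List.Relation.Unary.Unique.Propositional.Properties using (allFin⁺; filter⁺)
open import Data.List.Membership.Propositional.Properties using (∈-filter⁺; ∈-allFin; ∈-length)
open import Function using (_∘_; _⇔_; mk⇔; Equivalence)
open import Function.Definitions using (Injective)
open import Relation.Binary.Definitions using (Symmetric)
open import Relation.Nullary using (¬_; yes; no; ¬?)
open import Relation.Nullary.Decidable using (toWitness; decidable-stable; _×-dec_; _→-dec_)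
open import Relation.Unary using (Decidable)
open import Relation.Binary.PropositionalEquality using (_≡_; _≢_; refl; ≢-sym)
import Relation.Binary.PropositionalEquality as ≡

module _ {n : ℕ} (G : Graph n) where

  Adj-sym : Symmetric (Adj G)
  Adj-sym {p} {q} e = ≡.trans (sym G q p) e

  Adj⇒≢ : ∀ {p q} → Adj G p q → p ≢ q
  Adj⇒≢ {p} e refl with ≡.trans (≡.sym e) (irrefl G p)
  ... | ()

  module _ {u v : Fin n} where

    AdjPlus-new : AdjPlus G u v u v
    AdjPlus-new = inj₂ (inj₁ (refl , refl))

    AdjPlus-sym : Symmetric (AdjPlus G u v)
    AdjPlus-sym (inj₁ e)                  = inj₁ (Adj-sym e)
    AdjPlus-sym (inj₂ (inj₁ (p≡u , q≡v))) = inj₂ (inj₂ (q≡v , p≡u))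
    AdjPlus-sym (inj₂ (inj₂ (p≡v , q≡u))) = inj₂ (inj₁ (q≡u , p≡v))

    AdjPlus⇒≢ : u ≢ v → ∀ {p q} → AdjPlus G u v p q → p ≢ q
    AdjPlus⇒≢ u≢v (inj₁ e)                    = Adj⇒≢ e
    AdjPlus⇒≢ u≢v (inj₂ (inj₁ (refl , refl))) = u≢v
    AdjPlus⇒≢ u≢v (inj₂ (inj₂ (refl , refl))) = ≢-sym u≢v

    AdjPlus⇒Adj : ∀ {p q} → AdjPlus G u v p q → p ≢ u → p ≢ v → Adj G p q
    AdjPlus⇒Adj (inj₁ e)                 _   _   = e
    AdjPlus⇒Adj (inj₂ (inj₁ (p≡u , _))) p≢u _   = ⊥-elim (p≢u p≡u)
    AdjPlus⇒Adj (inj₂ (inj₂ (p≡v , _))) _   p≢v = ⊥-elim (p≢v p≡v)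

module DiamondIn {n : ℕ} {R : Fin n → Fin n → Set}
                 (R-sym : Symmetric R) (R⇒≢ : ∀ {p q} → R p q → p ≢ q) where

  quad : Fin n → Fin n → Fin n → Fin n → Fin 4 → Fin n
  quad a b c d zero                   = a
  quad a b c d (suc zero)             = b
  quad a b c d (suc (suc zero))       = c
  quad a b c d (suc (suc (suc zero))) = d

  -- Spine ab, tips c and d.
  diamond : ∀ {a b c d} → R a b → R a c → R a d → R b c → R b d → c ≢ d → Embedding Diamond R
  diamond {a} {b} {c} {d} ab ac ad bc bd c≢d =
    record { map = quad a b c d ; inj = injective ; edges = edge }
    where
    injective : Injective _≡_ _≡_ (quad a b c d)
    injective {zero}                 {zero}                 _ = refl
    injective {zero}                 {suc zero}             e = ⊥-elim (R⇒≢ ab e)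
    injective {zero}                 {suc (suc zero)}       e = ⊥-elim (R⇒≢ ac e)
    injective {zero}                 {suc (suc (suc zero))} e = ⊥-elim (R⇒≢ ad e)
    injective {suc zero}             {zero}                 e = ⊥-elim (R⇒≢ ab (≡.sym e))
    injective {suc zero}             {suc zero}             _ = refl
    injective {suc zero}             {suc (suc zero)}       e = ⊥-elim (R⇒≢ bc e)
    injective {suc zero}             {suc (suc (suc zero))} e = ⊥-elim (R⇒≢ bd e)
    injective {suc (suc zero)}       {zero}                 e = ⊥-elim (R⇒≢ ac (≡.sym e))
    injective {suc (suc zero)}       {suc zero}             e = ⊥-elim (R⇒≢ bc (≡.sym e))
    injective {suc (suc zero)}       {suc (suc zero)}       _ = refl
    injective {suc (suc zero)}       {suc (suc (suc zero))} e = ⊥-elim (c≢d e)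
    injective {suc (suc (suc zero))} {zero}                 e = ⊥-elim (R⇒≢ ad (≡.sym e))
    injective {suc (suc (suc zero))} {suc zero}             e = ⊥-elim (R⇒≢ bd (≡.sym e))
    injective {suc (suc (suc zero))} {suc (suc zero)}       e = ⊥-elim (c≢d (≡.sym e))
    injective {suc (suc (suc zero))} {suc (suc (suc zero))} _ = refl

    edge : ∀ i j → Adj Diamond i j → R (quad a b c d i) (quad a b c d j)
    edge zero                   (suc zero)             _ = ab
    edge zero                   (suc (suc zero))       _ = ac
    edge zero                   (suc (suc (suc zero))) _ = ad
    edge (suc zero)             zero                   _ = R-sym ab
    edge (suc zero)             (suc (suc zero))       _ = bc
    edge (suc zero)             (suc (suc (suc zero))) _ = bd
    edge (suc (suc zero))       zero                   _ = R-sym ac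
    edge (suc (suc zero))       (suc zero)             _ = R-sym bc
    edge (suc (suc (suc zero))) zero                   _ = R-sym ad
    edge (suc (suc (suc zero))) (suc zero)             _ = R-sym bd

  diamond-avoids : ∀ {a b c d y} (ab : R a b) (ac : R a c) (ad : R a d) (bc : R b c) (bd : R b d)
    (c≢d : c ≢ d) → a ≢ y → b ≢ y → c ≢ y → d ≢ y → ¬ ImgVertex (diamond ab ac ad bc bd c≢d) y
  diamond-avoids _ _ _ _ _ _ a≢y _ _ _ (zero                 , a≡y) = a≢y a≡y
  diamond-avoids _ _ _ _ _ _ _ b≢y _ _ (suc zero             , b≡y) = b≢y b≡y
  diamond-avoids _ _ _ _ _ _ _ _ c≢y _ (suc (suc zero)       , c≡y) = c≢y c≡y
  diamond-avoids _ _ _ _ _ _ _ _ _ d≢y (suc (suc (suc zero)) , d≡y) = d≢y d≡y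

Diamond-edge-in-triangle : ∀ a b → Adj Diamond a b → ∃[ c ] (Adj Diamond c a × Adj Diamond c b)
Diamond-edge-in-triangle = toWitness {a? = all? λ a → all? λ b →
  Adj? Diamond a b →-dec any? λ c → Adj? Diamond c a ×-dec Adj? Diamond c b} _

fresh-index : ∀ (i j : Fin 3) → ∃[ k ] (i ≢ k × j ≢ k)
fresh-index = toWitness {a? = all? λ i → all? λ j → any? λ k → ¬? (i ≟ k) ×-dec ¬? (j ≟ k)} _

ExactlyOneCopy⇒ImgVertex : ∀ {m n} {H : Graph m} {R : Fin n → Fin n → Set} → ExactlyOneCopy H R
  → (f g : Embedding H R) → ∀ {x} → ImgVertex f x → ImgVertex g x
ExactlyOneCopy⇒ImgVertex (_ , same) f g {x} fx =
  Equivalence.to (proj₁ (same g) x) (Equivalence.from (proj₁ (same f) x) fx)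

module _ {m n : ℕ} {H : Graph m} (G : Graph n) {u v : Fin n} where

  avoids-or-uses-new-edge : (f : Embedding H (AdjPlus G u v))
    → Embedding H (Adj G) ⊎ ∃[ a ] ∃[ b ] (Adj H a b × map f a ≡ u × map f b ≡ v)
  avoids-or-uses-new-edge f
    with any? (λ a → any? λ b → Adj? H a b ×-dec (map f a ≟ u ×-dec map f b ≟ v))
  ... | yes uses = inj₂ uses
  ... | no ¬uses = inj₁ record { map = map f ; inj = inj f ; edges = edge }
    where
    edge : ∀ a b → Adj H a b → Adj G (map f a) (map f b)
    edge a b ab with edges f a b ab
    ... | inj₁ e                    = e
    ... | inj₂ (inj₁ (fa≡u , fb≡v)) = ⊥-elim (¬uses (a , b , ab , fa≡u , fb≡v))
    ... | inj₂ (inj₂ (fa≡v , fb≡u)) = ⊥-elim (¬uses (b , a , Adj-sym H ab , fb≡u , fa≡v))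

  new-edge-in-triangle : (∀ a b → Adj H a b → ∃[ c ] (Adj H c a × Adj H c b))
    → ¬ Embedding H (Adj G) → Embedding H (AdjPlus G u v) → ∃[ w ] (Adj G w u × Adj G w v)
  new-edge-in-triangle triangles H-free f with avoids-or-uses-new-edge f
  ... | inj₁ e = ⊥-elim (H-free e)
  ... | inj₂ (a , b , ab , fa≡u , fb≡v) with triangles a b ab
  ...   | c , ca , cb = map f c , ≡.subst (Adj G (map f c)) fa≡u (lift ca)
                                , ≡.subst (Adj G (map f c)) fb≡v (lift cb)
    where
    lift : ∀ {x} → Adj H c x → Adj G (map f c) (map f x)
    lift cx = AdjPlus⇒Adj G (edges f c _ cx)
      (λ fc≡u → Adj⇒≢ H ca (inj f (≡.trans fc≡u (≡.sym fa≡u))))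
      (λ fc≡v → Adj⇒≢ H cb (inj f (≡.trans fc≡v (≡.sym fb≡v))))

triangle-apex-unique : ∀ {n} (G : Graph n) → ¬ Embedding Diamond (Adj G)
  → ∀ {a b c d} → Adj G a b → Adj G a c → Adj G b c → Adj G a d → Adj G b d → c ≡ d
triangle-apex-unique G free {c = c} {d} ab ac bc ad bd =
  decidable-stable (c ≟ d) (free ∘ diamond ab ac ad bc bd)
  where open DiamondIn (Adj-sym G) (Adj⇒≢ G)

module _ {n : ℕ} (G : Graph n) (US : UniquelySaturated Diamond G) where

  at-most-two-common-neighbours : ∀ {u v p q r} → u ≢ v → ¬ Adj G u v
    → Adj G u p → Adj G v p → Adj G u q → Adj G v q → Adj G u r → Adj G v r
    → p ≢ q → p ≢ r → q ≢ r → ⊥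
  at-most-two-common-neighbours u≢v ¬uv up vp uq vq ur vr p≢q p≢r q≢r =
    diamond-avoids new (inj₁ up) (inj₁ uq) (inj₁ vp) (inj₁ vq) p≢q
      (Adj⇒≢ G ur) (Adj⇒≢ G vr) p≢r q≢r
      (ExactlyOneCopy⇒ImgVertex (proj₂ US _ _ u≢v ¬uv)
        (diamond new (inj₁ up) (inj₁ ur) (inj₁ vp) (inj₁ vr) p≢r)
        (diamond new (inj₁ up) (inj₁ uq) (inj₁ vp) (inj₁ vq) p≢q)
        (suc (suc (suc zero)) , refl))
    where
    open DiamondIn (AdjPlus-sym G) (AdjPlus⇒≢ G u≢v)
    new : AdjPlus G _ _ _ _
    new = AdjPlus-new G

  -- G + bx contains the diamond abcx; a path x–y–(a or b) would give a second one through y.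
  triangle-neighbours-independent : ∀ {a b c x y}
    → Adj G a b → Adj G a c → Adj G b c → Adj G a x → b ≢ x → c ≢ x
    → Adj G x y → a ≢ y → b ≢ y → c ≢ y → ¬ (Adj G a y ⊎ Adj G b y)
  triangle-neighbours-independent {a} {b} {c} {x} {y} ab ac bc ax b≢x c≢x xy a≢y b≢y c≢y ay⊎by =
    diamond-avoids (inj₁ ab) (inj₁ ac) (inj₁ ax) (inj₁ bc) bx c≢x a≢y b≢y c≢y (Adj⇒≢ G xy)
      (ExactlyOneCopy⇒ImgVertex unique (second ay⊎by) abcx (y-in-second ay⊎by))
    where
    ¬bx : ¬ Adj G b x
    ¬bx = c≢x ∘ triangle-apex-unique G (proj₁ US) ab ac bc ax
    open DiamondIn (AdjPlus-sym G) (AdjPlus⇒≢ G b≢x)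
    unique : ExactlyOneCopy Diamond (AdjPlus G b x)
    unique = proj₂ US b x b≢x ¬bx
    bx : AdjPlus G b x b x
    bx = AdjPlus-new G
    xb : AdjPlus G b x x b
    xb = AdjPlus-sym G bx
    xa : AdjPlus G b x x a
    xa = inj₁ (Adj-sym G ax)
    abcx : Embedding Diamond (AdjPlus G b x)
    abcx = diamond (inj₁ ab) (inj₁ ac) (inj₁ ax) (inj₁ bc) bx c≢x
    second : Adj G a y ⊎ Adj G b y → Embedding Diamond (AdjPlus G b x)
    second (inj₁ ay) = diamond xa (inj₁ xy) xb (inj₁ ay) (inj₁ ab) (≢-sym b≢y)
    second (inj₂ by) = diamond xb xa (inj₁ xy) (inj₁ (Adj-sym G ab)) (inj₁ by) a≢y
    y-in-second : (ay⊎by : Adj G a y ⊎ Adj G b y) → ImgVertex (second ay⊎by) y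
    y-in-second (inj₁ _) = suc (suc zero) , refl
    y-in-second (inj₂ _) = suc (suc (suc zero)) , refl

unique-length≤2 : ∀ {A : Set} {P : A → Set} {xs : List A} → Unique xs → All P xs
  → (∀ {p q r} → P p → P q → P r → p ≢ q → p ≢ r → q ≢ r → ⊥) → length xs ≤ 2
unique-length≤2 {xs = []}               _ _ _ = z≤n
unique-length≤2 {xs = _ ∷ []}           _ _ _ = s≤s z≤n
unique-length≤2 {xs = _ ∷ _ ∷ []}       _ _ _ = s≤s (s≤s z≤n)
unique-length≤2 {xs = _ ∷ _ ∷ _ ∷ _} ((p≢q ∷ p≢r ∷ _) ∷ (q≢r ∷ _) ∷ _) (Pp ∷ Pq ∷ Pr ∷ _) no-three =
  ⊥-elim (no-three Pp Pq Pr p≢q p≢r q≢r)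

module _ {n : ℕ} {P : Fin n → Set} (P? : Decidable P) where

  count-positive : ∃[ x ] P x → 1 ≤ length (filter P? (allFin n))
  count-positive (x , Px) = ∈-length (∈-filter⁺ P? (∈-allFin x) Px)

  count≤2 : (∀ {p q r} → P p → P q → P r → p ≢ q → p ≢ r → q ≢ r → ⊥)
    → length (filter P? (allFin n)) ≤ 2
  count≤2 = unique-length≤2 (filter⁺ P? (allFin⁺ n)) (all-filter P? (allFin n))

module TriangleNeighbourhood {n : ℕ} (G : Graph n) (t : Fin 3 → Fin n)
         (US : UniquelySaturated Diamond G) (T : IsTriangle G t) where

  S : Fin n → Set
  S = TriS t

  ∉S⇒≢ : ∀ {x} → ¬ S x → ∀ k → t k ≢ x
  ∉S⇒≢ x∉S k tk≡x = x∉S (k , ≡.sym tk≡x)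

  Vi⇒NSet : ∀ {i x} → Vi G t i x → NSet G S x
  Vi⇒NSet {i} (ix , x∉S) = x∉S , t i , (i , refl) , ix

  NSet⇒Vi : ∀ {x} → NSet G S x → ∃[ i ] Vi G t i x
  NSet⇒Vi (x∉S , _ , (i , refl) , ix) = i , ix , x∉S

  Vi-disjoint : ∀ i j → i ≢ j → ∀ x → Vi G t i x → ¬ Vi G t j x
  Vi-disjoint i j i≢j x (ix , x∉S) (jx , _) with fresh-index i j
  ... | k , i≢k , j≢k =
    ∉S⇒≢ x∉S k (triangle-apex-unique G (proj₁ US) (T i j i≢j) (T i k i≢k) (T j k j≢k) ix jx)

  Vi-neighbour-avoids : ∀ {i x y} → Vi G t i x → Adj G x y → ¬ S y
    → ∀ k → i ≢ k → ¬ (Adj G (t i) y ⊎ Adj G (t k) y)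
  Vi-neighbour-avoids {i} (ix , x∉S) xy y∉S k i≢k with fresh-index i k
  ... | l , i≢l , k≢l =
    triangle-neighbours-independent G US (T i k i≢k) (T i l i≢l) (T k l k≢l) ix
      (∉S⇒≢ x∉S k) (∉S⇒≢ x∉S l) xy (∉S⇒≢ y∉S i) (∉S⇒≢ y∉S k) (∉S⇒≢ y∉S l)

  NSet-independent : ∀ x y → NSet G S x → NSet G S y → ¬ Adj G x y
  NSet-independent x y Nx Ny xy with NSet⇒Vi Nx | NSet⇒Vi Ny
  ... | i , Vx | j , jy , y∉S with i ≟ j
  ...   | no i≢j   = Vi-neighbour-avoids Vx xy y∉S j i≢j (inj₂ jy)
  ...   | yes refl with fresh-index i i
  ...     | k , i≢k , _ = Vi-neighbour-avoids Vx xy y∉S k i≢k (inj₁ jy)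

  far-vertex-has-Vi-neighbour : ∀ {x} → ¬ S x → ¬ NSet G S x → ∀ i → ∃[ w ] (Vi G t i w × Adj G x w)
  far-vertex-has-Vi-neighbour {x} x∉S ¬Nx i
    with new-edge-in-triangle G Diamond-edge-in-triangle (proj₁ US)
           (proj₁ (proj₂ US (t i) x (∉S⇒≢ x∉S i) (¬Nx ∘ Vi⇒NSet ∘ (_, x∉S))))
  ... | w , w-ti , wx = w , (Adj-sym G w-ti , w∉S) , Adj-sym G wx
    where
    w∉S : ¬ S w
    w∉S (_ , refl) = ¬Nx (Vi⇒NSet (wx , x∉S))

  far-vertex-in-N2Set : ∀ {x} → ¬ S x → ¬ NSet G S x → N2Set G S x
  far-vertex-in-N2Set x∉S ¬Nx with far-vertex-has-Vi-neighbour x∉S ¬Nx zero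
  ... | w , Vw , xw = x∉S , ¬Nx , w , Vi⇒NSet Vw , Adj-sym G xw

  cover : ∀ x → S x ⊎ (NSet G S x ⊎ N2Set G S x)
  cover x with TriS? t x
  ... | yes x∈S = inj₁ x∈S
  ... | no x∉S with any? (λ i → Adj? G (t i) x)
  ...   | yes (i , ix) = inj₂ (inj₁ (Vi⇒NSet (ix , x∉S)))
  ...   | no ¬∃ix      = inj₂ (inj₂ (far-vertex-in-N2Set x∉S (¬∃ix ∘ map₂ proj₁ ∘ NSet⇒Vi)))

  N2Set-Vi-count : ∀ x → N2Set G S x → ∀ i → 1 ≤ nbrsInVi G t i x × nbrsInVi G t i x ≤ 2
  N2Set-Vi-count x (x∉S , ¬Nx , _) i =
    count-positive P? (far-vertex-has-Vi-neighbour x∉S ¬Nx i) ,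
    count≤2 P? λ ((ip , _) , xp) ((iq , _) , xq) ((ir , _) , xr) →
      at-most-two-common-neighbours G US (∉S⇒≢ x∉S i) (¬Nx ∘ Vi⇒NSet ∘ (_, x∉S)) ip xp iq xq ir xr
    where
    P? : Decidable (λ y → Vi G t i y × Adj G x y)
    P? = λ y → Vi? G t i y ×-dec Adj? G x y

lemma3p1 : ∀ {n} (G : Graph n) (t : Fin 3 → Fin n)
    → NontrivialUniquelySaturated Diamond G
    → IsTriangle G t
    → ((∀ x → TriS t x ⊎ (NSet G (TriS t) x ⊎ N2Set G (TriS t) x))
        × (∀ x → TriS t x → ¬ NSet G (TriS t) x)
        × (∀ x → TriS t x → ¬ N2Set G (TriS t) x)
        × (∀ x → NSet G (TriS t) x → ¬ N2Set G (TriS t) x))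
      × (∀ i j → ¬ i ≡ j → ∀ x → Vi G t i x → ¬ Vi G t j x)
      × ((∀ x → NSet G (TriS t) x ⇔ (∃[ i ] Vi G t i x))
        × (∀ x y → NSet G (TriS t) x → NSet G (TriS t) y → ¬ Adj G x y))
      × (∀ x → N2Set G (TriS t) x → ∀ i → 1 ≤ nbrsInVi G t i x × nbrsInVi G t i x ≤ 2)
lemma3p1 G t (_ , US) T =
  ( cover
  , (λ _ x∈S Nx → proj₁ Nx x∈S)
  , (λ _ x∈S N2x → proj₁ N2x x∈S)
  , (λ _ Nx N2x → proj₁ (proj₂ N2x) Nx))
  , Vi-disjoint
  , ((λ _ → mk⇔ NSet⇒Vi (Vi⇒NSet ∘ proj₂)) , NSet-independent)
  , N2Set-Vi-count
  where open TriangleNeighbourhood G t US T
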